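{- Let $(G,\preceq)$ be a partially ordered graph with $G=(V,E)$ and let $\ell$ be the $\alpha$-ranking of $(G,\preceq)$. Then $\ell(v)\le 2|V|$ for all $v\in V$, and every intersection representation of $(G,\preceq)$ is an $\ell$-constrained intersection representation of $G$. In particular, $\mathrm{in}(G,\ell)\le\mathrm{in}(G,\preceq)$.
   Context: $G$ is a finite simple graph and $\preceq$ a partial order on $V$; $u\prec v$ means $u\preceq v$, $u\ne v$. An intersection representation of $G$ is a pair $(U,\varphi)$, $U$ finite, $\varphi(v)\subseteq U$, with $\{u,v\}\in E$ iff $\varphi(u)\cap\varphi(v)\ne\emptyset$ for distinct $u,v$; it is $\ell$-constrained if $|\varphi(v)|\ge\ell(v)$ for all $v$, and $\mathrm{in}(G,\ell)$ is the minimum $|U|$ of such. An intersection representation of $(G,\preceq)$ is an intersection representation of $G$ with $|\varphi(u)|<|\varphi(v)|$ whenever $u\prec v$; $\mathrm{in}(G,\preceq)$ is its minimum $|U|$. The independence degree $\alpha\text{ - }\deg(v)$ is the maximum size of an independent set contained in $N(v)$. With $M$ the set of minimal elements of $(V,\preceq)$, the $\alpha$-ranking is $\ell(v)=\alpha\text{ - }\deg(v)$ for $v\in M$ and $\ell(v)=\max\{\alpha\text{ - }\deg(v),1+\max_{u\prec v}\ell(u)\}$ for $v\notin M$. -}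

module Defs where

open import Data.Nat using (ℕ; suc; _≤_; _<_; _+_)
open import Data.Fin using (Fin)
open import Data.Fin.Subset using (Subset; _∈_; _∩_; Nonempty; ∣_∣)
open import Data.Product using (Σ; _×_; ∃; ∃-syntax)
open import Data.Sum using (_⊎_)
open import Relation.Binary.PropositionalEquality using (_≡_; _≢_)
open import Relation.Nullary using (¬_)
open import Relation.Binary.Structures using (IsPartialOrder)

record Graph (n : ℕ) : Set₁ where
  field
    E     : Fin n → Fin n → Set
    sym   : ∀ {u v} → E u v → E v u
    irrefl : ∀ {v} → ¬ E v v

record POGraph (n : ℕ) : Set₁ where
  field
    G       : Graph n
    _≼_     : Fin n → Fin n → Set
    isPO    : IsPartialOrder _≡_ _≼_
  open Graph G public

  _≺_ : Fin n → Fin n → Set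
  u ≺ v = (u ≼ v) × (u ≢ v)

  Minimal : Fin n → Set
  Minimal v = ∀ u → ¬ (u ≺ v)

module _ {n : ℕ} (G : Graph n) where
  open Graph G

  IndepInNbhd : Fin n → Subset n → Set
  IndepInNbhd v S = (∀ x → x ∈ S → E v x) × (∀ x y → x ∈ S → y ∈ S → ¬ E x y)

  IsAlphaDeg : Fin n → ℕ → Set
  IsAlphaDeg v k = (∃[ S ] (IndepInNbhd v S × ∣ S ∣ ≡ k))
                 × (∀ S → IndepInNbhd v S → ∣ S ∣ ≤ k)

  IsIntRep : (m : ℕ) → (Fin n → Subset m) → Set
  IsIntRep m φ = ∀ u v → u ≢ v → (E u v → Nonempty (φ u ∩ φ v))
                                × (Nonempty (φ u ∩ φ v) → E u v)

  IsConstrainedIntRep : (Fin n → ℕ) → (m : ℕ) → (Fin n → Subset m) → Set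
  IsConstrainedIntRep ℓ m φ = IsIntRep m φ × (∀ v → ℓ v ≤ ∣ φ v ∣)

  IsInℓ : (Fin n → ℕ) → ℕ → Set
  IsInℓ ℓ k = (∃[ φ ] IsConstrainedIntRep ℓ k φ)
            × (∀ m φ → IsConstrainedIntRep ℓ m φ → k ≤ m)

module _ {n : ℕ} (P : POGraph n) where
  open POGraph P

  IsPOIntRep : (m : ℕ) → (Fin n → Subset m) → Set
  IsPOIntRep m φ = IsIntRep G m φ × (∀ u v → u ≺ v → ∣ φ u ∣ < ∣ φ v ∣)

  IsInPO : ℕ → Set
  IsInPO k = (∃[ φ ] IsPOIntRep k φ) × (∀ m φ → IsPOIntRep m φ → k ≤ m)

  -- ℓ is the α-ranking of (G , ≼):
  --   ℓ(v) = α-deg(v)                                 for v minimal,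
  --   ℓ(v) = max{ α-deg(v) , 1 + max_{u ≺ v} ℓ(u) }   otherwise.
  -- The max is expressed as: an upper bound of all the listed values
  -- which equals one of them.
  IsAlphaRanking : (Fin n → ℕ) → Set
  IsAlphaRanking ℓ = ∀ v →
      (Minimal v → IsAlphaDeg G v (ℓ v))
    × (¬ Minimal v →
         ∃[ a ] ( IsAlphaDeg G v a
                × a ≤ ℓ v
                × (∀ u → u ≺ v → suc (ℓ u) ≤ ℓ v)
                × (ℓ v ≡ a ⊎ ∃[ u ] (u ≺ v × ℓ v ≡ suc (ℓ u)))))

-- The α-ranking only ever exceeds a bound b at v by stepping down: if b(v) < ℓ(v) then v is
-- not minimal and ℓ(v) is not α-deg(v) (both are at most b(v)), so ℓ(v) = 1 + ℓ(u) for some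
-- u ≺ v. With b = n, every value between n + 1 and ℓ(v) is attained by ℓ, and distinct
-- values need distinct vertices, so ℓ(v) ≤ 2n. With b = |φ| for a representation of (G , ≼),
-- induction on ℓ(v) gives ℓ(v) = 1 + ℓ(u) ≤ 1 + |φ(u)| ≤ |φ(v)|; the base case α-deg(v) ≤ |φ(v)|
-- holds because the neighbours in an independent set of N(v) meet φ(v) in pairwise disjoint sets.
module Submission where

open import Defs
open import Data.Nat using (ℕ; _≤_; _*_)
open import Data.Fin using (Fin)
open import Data.Fin.Subset using (Subset)
open import Data.Product using (_×_)

open import Level using (Level)
open import Data.Nat using (zero; suc; _+_; _<_; z≤n; s≤s)
open import Data.Nat.Properties
  using (≤-trans; ≤-reflexive; <-≤-trans; <⇒≱; ≮⇒≥; n≮n; m≤m+n; +-monoʳ-≤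
        ; +-identityʳ; +-suc; +-cancelˡ-≡; suc-injective; m≤n⇒∃[o]m+o≡n; module ≤-Reasoning)
open import Data.Nat.Induction using (<-wellFounded)
open import Induction.WellFounded using (Acc; acc)
open import Data.Fin using (toℕ)
import Data.Fin.Properties as Finₚ
open import Data.Fin.Subset using (_∈_; _∩_; ∣_∣; inside; outside; _-_)
open import Data.Fin.Subset.Properties using (x∈p∩q⁺; x∈p∩q⁻; x∈p∧x≢y⇒x∈p-y; x∈p⇒∣p-x∣<∣p∣; ∣p∣≤n)
open import Data.Vec using (_∷_; []; here; there)
open import Data.Product using (_,_; proj₁; proj₂; ∃-syntax; map₂)
open import Data.Sum using (inj₁; inj₂)
open import Relation.Binary.Core using (Rel)
open import Relation.Binary.PropositionalEquality using (_≡_; refl; sym; trans; subst; cong; module ≡-Reasoning)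
open import Function.Base using (_∘_)
open import Function.Definitions using (Injective)
open import Relation.Nullary using (contradiction; yes; no)

injection⇒∣p∣≤∣q∣ : ∀ {n m} {p : Subset n} {q : Subset m} (f : ∀ {x} → x ∈ p → Fin m) →
  (∀ {x} (x∈p : x ∈ p) → f x∈p ∈ q) →
  (∀ {x y} (x∈p : x ∈ p) (y∈p : y ∈ p) → f x∈p ≡ f y∈p → x ≡ y) →
  ∣ p ∣ ≤ ∣ q ∣
injection⇒∣p∣≤∣q∣ {p = []} _ _ _ = z≤n
injection⇒∣p∣≤∣q∣ {p = outside ∷ p} f f∈q f-inj =
  injection⇒∣p∣≤∣q∣ (λ x∈p → f (there x∈p)) (λ x∈p → f∈q (there x∈p))
    (λ x∈p y∈p eq → Finₚ.suc-injective (f-inj (there x∈p) (there y∈p) eq))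
injection⇒∣p∣≤∣q∣ {p = inside ∷ p} {q} f f∈q f-inj = ≤-trans (s≤s ∣p∣≤∣q-f₀∣) (x∈p⇒∣p-x∣<∣p∣ (f∈q here))
  where
  ∣p∣≤∣q-f₀∣ : ∣ p ∣ ≤ ∣ q - f here ∣
  ∣p∣≤∣q-f₀∣ = injection⇒∣p∣≤∣q∣ (λ x∈p → f (there x∈p))
    (λ x∈p → x∈p∧x≢y⇒x∈p-y (f∈q (there x∈p)) λ eq → contradiction (f-inj (there x∈p) here eq) λ ())
    (λ x∈p y∈p eq → Finₚ.suc-injective (f-inj (there x∈p) (there y∈p) eq))

module _ {n : ℕ} (ℓ : Fin n → ℕ) {c : ℕ} (step : ∀ {v} → c < ℓ v → ∃[ u ] ℓ v ≡ suc (ℓ u)) where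

  levels-attained : ∀ d {v j} → c < j → j + d ≡ ℓ v → ∃[ u ] ℓ u ≡ j
  levels-attained zero    {v} {j} _   j+0≡ℓv = v , trans (sym j+0≡ℓv) (+-identityʳ j)
  levels-attained (suc d) {v} {j} c<j j+1+d≡ℓv =
    let u , ℓv≡1+ℓu = step (<-≤-trans c<j (subst (j ≤_) j+1+d≡ℓv (m≤m+n j (suc d))))
    in levels-attained d c<j (suc-injective (begin
         suc (j + d)  ≡⟨ +-suc j d ⟨
         j + suc d    ≡⟨ j+1+d≡ℓv ⟩
         ℓ v          ≡⟨ ℓv≡1+ℓu ⟩
         suc (ℓ u)    ∎))
    where open ≡-Reasoning

  ℓ≤c+n : ∀ v → ℓ v ≤ c + n
  ℓ≤c+n v = ≮⇒≥ λ c+n<ℓv → n≮n n (Finₚ.injective⇒≤ (level-injective c+n<ℓv))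
    where
    vertex-at-level : c + n < ℓ v → (i : Fin (suc n)) → ∃[ u ] ℓ u ≡ suc (c + toℕ i)
    vertex-at-level c+n<ℓv i =
      let d , j+d≡ℓv = m≤n⇒∃[o]m+o≡n (≤-trans (s≤s (+-monoʳ-≤ c (Finₚ.toℕ≤pred[n] i))) c+n<ℓv)
      in levels-attained d (s≤s (m≤m+n c (toℕ i))) j+d≡ℓv

    level-injective : (c+n<ℓv : c + n < ℓ v) → Injective _≡_ _≡_ (proj₁ ∘ vertex-at-level c+n<ℓv)
    level-injective c+n<ℓv {i} {j} eq =
      Finₚ.toℕ-injective (+-cancelˡ-≡ c _ _ (suc-injective (begin
        suc (c + toℕ i)                    ≡⟨ proj₂ (vertex-at-level c+n<ℓv i) ⟨
        ℓ (proj₁ (vertex-at-level c+n<ℓv i)) ≡⟨ cong ℓ eq ⟩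
        ℓ (proj₁ (vertex-at-level c+n<ℓv j)) ≡⟨ proj₂ (vertex-at-level c+n<ℓv j) ⟩
        suc (c + toℕ j)                    ∎)))
      where open ≡-Reasoning

module _ {a r : Level} {A : Set a} {_⊏_ : Rel A r} (ℓ b : A → ℕ)
         (step : ∀ {v} → b v < ℓ v → ∃[ u ] (u ⊏ v × ℓ v ≡ suc (ℓ u)))
         (b-strictMono : ∀ {u v} → u ⊏ v → b u < b v) where

  ℓ≤b : ∀ v → ℓ v ≤ b v
  ℓ≤b v = go v (<-wellFounded (ℓ v))
    where
    go : ∀ v → Acc _<_ (ℓ v) → ℓ v ≤ b v
    go v (acc rec) = ≮⇒≥ λ bv<ℓv →
      let u , u⊏v , ℓv≡1+ℓu = step bv<ℓv
      in <⇒≱ bv<ℓv (begin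
           ℓ v        ≡⟨ ℓv≡1+ℓu ⟩
           suc (ℓ u)  ≤⟨ s≤s (go u (rec (≤-reflexive (sym ℓv≡1+ℓu)))) ⟩
           suc (b u)  ≤⟨ b-strictMono u⊏v ⟩
           b v        ∎)
      where open ≤-Reasoning

module _ {n : ℕ} (G : Graph n) where
  open Graph G using (irrefl)

  α-deg≤n : ∀ {v k} → IsAlphaDeg G v k → k ≤ n
  α-deg≤n ((S , _ , ∣S∣≡k) , _) = subst (_≤ n) ∣S∣≡k (∣p∣≤n S)

  module _ {m : ℕ} {φ : Fin n → Subset m} (rep : IsIntRep G m φ) where

    indep-in-nbhd≤∣φ∣ : ∀ {v S} → IndepInNbhd G v S → ∣ S ∣ ≤ ∣ φ v ∣
    indep-in-nbhd≤∣φ∣ {v} {S} (adj , indep) = injection⇒∣p∣≤∣q∣ witness (proj₁ ∘ witness∈φv∩φx) witness-injective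
      where
      meet : ∀ {x} → x ∈ S → ∃[ i ] i ∈ φ v ∩ φ x
      meet {x} x∈S = proj₁ (rep v x λ { refl → irrefl (adj x x∈S) }) (adj x x∈S)

      witness : ∀ {x} → x ∈ S → Fin m
      witness = proj₁ ∘ meet

      witness∈φv∩φx : ∀ {x} (x∈S : x ∈ S) → witness x∈S ∈ φ v × witness x∈S ∈ φ x
      witness∈φv∩φx {x} x∈S = x∈p∩q⁻ (φ v) (φ x) (proj₂ (meet x∈S))

      witness-injective : ∀ {x y} (x∈S : x ∈ S) (y∈S : y ∈ S) → witness x∈S ≡ witness y∈S → x ≡ y
      witness-injective {x} {y} x∈S y∈S eq with x Finₚ.≟ y
      ... | yes x≡y = x≡y
      ... | no x≢y = contradiction (proj₂ (rep x y x≢y) (witness x∈S , x∈p∩q⁺ (witness∈φx , witness∈φy)))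
                                   (indep x y x∈S y∈S)
        where
        witness∈φx : witness x∈S ∈ φ x
        witness∈φx = proj₂ (witness∈φv∩φx x∈S)
        witness∈φy : witness x∈S ∈ φ y
        witness∈φy = subst (_∈ φ y) (sym eq) (proj₂ (witness∈φv∩φx y∈S))

    α-deg≤∣φ∣ : ∀ {v k} → IsAlphaDeg G v k → k ≤ ∣ φ v ∣
    α-deg≤∣φ∣ {v} ((S , S-indep , ∣S∣≡k) , _) = subst (_≤ ∣ φ v ∣) ∣S∣≡k (indep-in-nbhd≤∣φ∣ S-indep)

module _ {n : ℕ} (P : POGraph n) {ℓ : Fin n → ℕ} (ranking : IsAlphaRanking P ℓ) where
  open POGraph P using (_≺_)

  α-ranking-step : (b : Fin n → ℕ) → (∀ {v k} → IsAlphaDeg (POGraph.G P) v k → k ≤ b v) →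
                   ∀ {v} → b v < ℓ v → ∃[ u ] (u ≺ v × ℓ v ≡ suc (ℓ u))
  α-ranking-step b α-deg≤b {v} bv<ℓv
    with proj₂ (ranking v) (<⇒≱ bv<ℓv ∘ α-deg≤b ∘ proj₁ (ranking v))
  ... | _ , α-deg , _ , _ , inj₁ ℓv≡α-deg = contradiction (subst (_≤ b v) (sym ℓv≡α-deg) (α-deg≤b α-deg)) (<⇒≱ bv<ℓv)
  ... | _ , _     , _ , _ , inj₂ step     = step

lemma13 : (n : ℕ) (P : POGraph n) (ℓ : Fin n → ℕ) → IsAlphaRanking P ℓ →
    (∀ v → ℓ v ≤ 2 * n)
    × (∀ (m : ℕ) (φ : Fin n → Subset m) → IsPOIntRep P m φ → IsConstrainedIntRep (POGraph.G P) ℓ m φ)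
    × (∀ (a b : ℕ) → IsInℓ (POGraph.G P) ℓ a → IsInPO P b → a ≤ b)
lemma13 n P ℓ ranking = ℓ≤2n , constrained , in-ℓ≤in-≼
  where
  G : Graph n
  G = POGraph.G P

  ℓ≤2n : ∀ v → ℓ v ≤ 2 * n
  ℓ≤2n v = subst (ℓ v ≤_) (cong (n +_) (sym (+-identityʳ n)))
    (ℓ≤c+n ℓ (map₂ proj₂ ∘ α-ranking-step P ranking (λ _ → n) (α-deg≤n G)) v)

  constrained : ∀ m φ → IsPOIntRep P m φ → IsConstrainedIntRep G ℓ m φ
  constrained m φ (rep , φ-strictMono) = rep ,
    ℓ≤b ℓ (∣_∣ ∘ φ) (α-ranking-step P ranking (∣_∣ ∘ φ) (α-deg≤∣φ∣ G rep)) (φ-strictMono _ _)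

  in-ℓ≤in-≼ : ∀ a b → IsInℓ G ℓ a → IsInPO P b → a ≤ b
  in-ℓ≤in-≼ a b (_ , a-minimum) ((φ , rep) , _) = a-minimum b φ (constrained b φ rep)
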